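{- Let $G$ be a connected graph, and let $G'$ be a connected graph (with at least $3$ vertices) obtained from $G$ by contracting some edges. Then $rx_3(G)\leq rx_3(G')+|V(G)|-|V(G')|$.
   Context: All graphs are simple, finite and undirected. To contract an edge $e=xy$ is to delete $e$ and replace its ends by a single vertex incident to all edges that were incident to $x$ or $y$. For a connected graph $G$ with an edge-coloring $c:E(G)\to\{1,\dots,q\}$ (adjacent edges may receive the same color), a tree $T$ in $G$ is a rainbow tree if no two edges of $T$ receive the same color; for $S\subseteq V(G)$, an $S$-tree is a tree in $G$ containing all vertices of $S$. The coloring is a $3$-rainbow coloring if for every $3$-element subset $S\subseteq V(G)$ there is a rainbow $S$-tree, and $rx_3(G)$ is the minimum number of colors in a $3$-rainbow coloring of $G$ (defined for connected graphs of order at least $3$). -}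

module Defs where

open import Data.Nat using (ℕ; zero; suc; _≤_)
open import Data.Fin using (Fin; zero; suc; inject₁; fromℕ)
open import Data.Bool using (Bool; true; false; T)
open import Data.Product using (Σ; _×_; _,_; ∃)
open import Data.Sum using (_⊎_)
open import Relation.Binary.PropositionalEquality using (_≡_; _≢_)
open import Function.Definitions using (Injective; Surjective)
open import Function.Bundles using (_⇔_)
open import Relation.Nullary using (¬_)

record Graph (n : ℕ) : Set where
  field
    adj    : Fin n → Fin n → Bool
    sym    : ∀ i j → adj i j ≡ adj j i
    irrefl : ∀ i → adj i i ≡ false

Edge : ∀ {n} → Graph n → Fin n → Fin n → Set
Edge G i j = T (Graph.adj G i j)

data Walk {n : ℕ} (R : Fin n → Fin n → Set) : Fin n → Fin n → Set where
  here : ∀ {u} → Walk R u u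
  step : ∀ {u w v} → R u w → Walk R w v → Walk R u v

Connected : ∀ {n} → Graph n → Set
Connected {n} G = ∀ (u v : Fin n) → Walk (Edge G) u v

record Coloring {n : ℕ} (G : Graph n) (q : ℕ) : Set where
  field
    col    : ∀ i j → Edge G i j → Fin q
    colSym : ∀ i j (p : Edge G i j) (p' : Edge G j i) → col i j p ≡ col j i p'

SameEdge : ∀ {n} → Fin n → Fin n → Fin n → Fin n → Set
SameEdge i j k l = (i ≡ k × j ≡ l) ⊎ (i ≡ l × j ≡ k)

record Cycle {n : ℕ} (E : Fin n → Fin n → Set) : Set where
  field
    len      : ℕ      -- cycle has length len + 3
    vtx      : Fin (suc (suc (suc len))) → Fin n
    distinct : Injective _≡_ _≡_ vtx
    consec   : ∀ (i : Fin (suc (suc len))) → E (vtx (inject₁ i)) (vtx (suc i))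
    close    : E (vtx (fromℕ (suc (suc len)))) (vtx zero)

record Tree {n : ℕ} (G : Graph n) : Set₁ where
  field
    V       : Fin n → Set
    E       : Fin n → Fin n → Set
    Esym    : ∀ i j → E i j → E j i
    EinG    : ∀ i j → E i j → Edge G i j
    Eends   : ∀ i j → E i j → V i × V j
    conn    : ∀ u v → V u → V v → Walk E u v
    acyclic : ¬ Cycle E

Rainbow : ∀ {n q} {G : Graph n} → Coloring G q → Tree G → Set
Rainbow {G = G} c T = ∀ i j k l (p : Tree.E T i j) (p' : Tree.E T k l) →
  Coloring.col c i j (Tree.EinG T i j p) ≡ Coloring.col c k l (Tree.EinG T k l p') →
  SameEdge i j k l

Is3Rainbow : ∀ {n q} {G : Graph n} → Coloring G q → Set₁
Is3Rainbow {n} {G = G} c = ∀ (x y z : Fin n) → x ≢ y → x ≢ z → y ≢ z →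
  Σ (Tree G) λ T → Rainbow c T × Tree.V T x × Tree.V T y × Tree.V T z

Has3RainbowColoring : ∀ {n} → Graph n → ℕ → Set₁
Has3RainbowColoring G q = Σ (Coloring G q) Is3Rainbow

IsRx3 : ∀ {n} → Graph n → ℕ → Set₁
IsRx3 G k = Has3RainbowColoring G k × (∀ q → Has3RainbowColoring G q → k ≤ q)

Isomorphic : ∀ {n m} → Graph n → Graph m → Set
Isomorphic {n} {m} G H = Σ (Fin n → Fin m) λ φ →
  Injective _≡_ _≡_ φ × Surjective _≡_ _≡_ φ ×
  (∀ u v → Graph.adj H (φ u) (φ v) ≡ Graph.adj G u v)

-- H' is (up to relabelling) obtained from H by contracting the edge xy:
-- φ identifies exactly x and y, and two new vertices are adjacent iff they are
-- distinct and some edge of H joins their preimages (parallel edges merged).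
ContractOne : ∀ {m} → Graph (suc m) → Graph m → Set
ContractOne {m} H H' = Σ (Fin (suc m)) λ x → Σ (Fin (suc m)) λ y → Edge H x y ×
  Σ (Fin (suc m) → Fin m) λ φ → Surjective _≡_ _≡_ φ ×
  (∀ u v → (φ u ≡ φ v) ⇔ (u ≡ v ⊎ SameEdge u v x y)) ×
  (∀ a b → Edge H' a b ⇔ (a ≢ b × Σ (Fin (suc m)) λ u → Σ (Fin (suc m)) λ v →
                             φ u ≡ a × φ v ≡ b × Edge H u v))

data ContractsTo {n : ℕ} (G : Graph n) : ∀ {m} → Graph m → Set₁ where
  none : ∀ {m} {G' : Graph m} → Isomorphic G G' → ContractsTo G G'
  more : ∀ {m} {H : Graph (suc m)} {G' : Graph m} →
         ContractsTo G H → ContractOne H G' → ContractsTo G G'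

-- Along a chain of contractions it suffices to treat a single contraction H ↦ H/xy
-- with quotient map φ (contract-step); the chain starts with an isomorphism, along which
-- 3-rainbow colorings pull back (Pullback), and extra colors never hurt (more-colors).
-- Given a 3-rainbow coloring c' of H/xy with q colors, color H with q + 1 colors: xy gets the
-- new color, every other edge uv the color c'(φu φv) (liftColoring).  For three vertices of H
-- take a rainbow tree T' of H/xy containing their images (coverTriple; here |V(H/xy)| ≥ 3 is
-- used when the images coincide) and lift it (Contraction.Lift): the lift has vertex set
-- φ⁻¹(V(T')), the edge xy when the merged vertex lies in T', and one preimage edge of each
-- edge of T'.  Walks of T' lift, so the lift is connected; a cycle of the lift, rerouted
-- through x instead of y (ListCycles.Shortcut), maps to a cycle of T', so it is acyclic; and
-- distinct lifted edges lie over distinct edges of T', so it is rainbow.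

module Submission where

open import Defs
open import Data.Nat using (ℕ; zero; suc; _≤_; _+_; _∸_; z≤n; s≤s)
open import Data.Nat.Properties using (≤-trans; ≤-reflexive; m≤m+n; n≤1+n; +-suc; +-∸-assoc)
open import Data.Fin using (Fin; zero; suc; inject₁; inject≤; fromℕ; _≟_)
open import Data.Fin.Properties
  using (fromℕ≢inject₁; inject₁-injective; inject≤-injective; injective⇒≤)
open import Data.Bool using (T)
open import Data.Bool.Properties using (T-irrelevant)
open import Data.List using (List; []; _∷_; _++_; length; map; tabulate; lookup)
open import Data.List.Properties using (length-map; length-tabulate; length-++-comm)
open import Data.List.Relation.Unary.All as All using (All; []; _∷_)
open import Data.List.Relation.Unary.All.Properties using (++⁻ˡ; ++⁻ʳ; All-swap; ¬Any⇒All¬)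
open import Data.List.Relation.Unary.AllPairs using ([]; _∷_)
import Data.List.Relation.Unary.AllPairs.Properties as AllPairs
open import Data.List.Relation.Unary.Unique.Propositional using (Unique)
open import Data.List.Membership.Propositional.Properties using (∈-∃++; ∈-lookup)
open import Data.Product using (Σ; ∃; ∃₂; _×_; _,_; proj₁; proj₂)
open import Data.Sum using (_⊎_; inj₁; inj₂)
open import Data.Empty using (⊥-elim)
open import Function.Bundles using (_⇔_; Equivalence)
open import Function.Definitions using (Injective; Surjective)
open import Relation.Binary.PropositionalEquality
  using (_≡_; _≢_; refl; sym; trans; cong; subst; subst₂; ≢-sym; module ≡-Reasoning)
open import Relation.Nullary using (¬_; Dec; yes; no)
open import Relation.Nullary.Decidable using (T?; _×-dec_; _⊎-dec_)

edge-sym : ∀ {n} (G : Graph n) {u v} → Edge G u v → Edge G v u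
edge-sym G {u} {v} = subst T (Graph.sym G u v)

edge-irrefl : ∀ {n} (G : Graph n) {u} → ¬ Edge G u u
edge-irrefl G {u} = subst T (Graph.irrefl G u)

col-irrelevant : ∀ {n q} {G : Graph n} (c : Coloring G q) {i j} (p p' : Edge G i j) →
                 Coloring.col c i j p ≡ Coloring.col c i j p'
col-irrelevant c {i} {j} p p' = cong (Coloring.col c i j) (T-irrelevant p p')

swap-edge : ∀ {n} {u v x y : Fin n} → SameEdge u v x y → SameEdge v u x y
swap-edge (inj₁ (u≡x , v≡y)) = inj₂ (v≡y , u≡x)
swap-edge (inj₂ (u≡y , v≡x)) = inj₁ (v≡x , u≡y)

same-edge? : ∀ {n} (u v x y : Fin n) → Dec (SameEdge u v x y)
same-edge? u v x y = (u ≟ x ×-dec v ≟ y) ⊎-dec (u ≟ y ×-dec v ≟ x)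

_++ʷ_ : ∀ {n} {R : Fin n → Fin n → Set} {a b c} → Walk R a b → Walk R b c → Walk R a c
here ++ʷ w = w
step r p ++ʷ w = step r (p ++ʷ w)

module ListCycles {N : ℕ} where

  open import Data.List.Membership.DecPropositional (_≟_ {N}) using (_∈?_)

  infixr 5 _▸_

  -- Path R u v vs: an R-walk from u to v; vs lists its vertices except the last one.
  data Path (R : Fin N → Fin N → Set) : Fin N → Fin N → List (Fin N) → Set where
    end : ∀ {u} → Path R u u []
    _▸_ : ∀ {u w v vs} → R u w → Path R w v vs → Path R u v (u ∷ vs)

  record ListCycle (R : Fin N → Fin N → Set) : Set where
    constructor listCycle
    field
      {start} : Fin N
      verts   : List (Fin N)
      path    : Path R start start verts
      unique  : Unique verts
      long    : 3 ≤ length verts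

  module _ {R : Fin N → Fin N → Set} where

    _++ₚ_ : ∀ {a b c xs ys} → Path R a b xs → Path R b c ys → Path R a c (xs ++ ys)
    end ++ₚ q = q
    (r ▸ p) ++ₚ q = r ▸ (p ++ₚ q)

    splitPath : ∀ {a c} xs {ys} → Path R a c (xs ++ ys) → ∃ λ b → Path R a b xs × Path R b c ys
    splitPath [] q = _ , end , q
    splitPath (x ∷ xs) (r ▸ q) with splitPath xs q
    ... | b , q₁ , q₂ = b , r ▸ q₁ , q₂

  unique-++⁻ : ∀ xs {ys : List (Fin N)} → Unique (xs ++ ys) →
               Unique xs × Unique ys × All (λ z → All (z ≢_) ys) xs
  unique-++⁻ [] u = [] , u , []
  unique-++⁻ (x ∷ xs) (x∉ ∷ u) with unique-++⁻ xs u
  ... | uxs , uys , disjoint = ++⁻ˡ xs x∉ ∷ uxs , uys , ++⁻ʳ xs x∉ ∷ disjoint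

  unique-rotate : ∀ xs {ys : List (Fin N)} → Unique (xs ++ ys) → Unique (ys ++ xs)
  unique-rotate xs u with unique-++⁻ xs u
  ... | uxs , uys , disjoint = AllPairs.++⁺ uys uxs (All.map (All.map ≢-sym) (All-swap disjoint))

  lookup-injective : ∀ {xs : List (Fin N)} → Unique xs → ∀ {i j} → lookup xs i ≡ lookup xs j → i ≡ j
  lookup-injective (_ ∷ _) {zero} {zero} _ = refl
  lookup-injective (x∉ ∷ _) {zero} {suc j} e = ⊥-elim (All.lookup x∉ (∈-lookup j) e)
  lookup-injective (x∉ ∷ _) {suc i} {zero} e = ⊥-elim (All.lookup x∉ (∈-lookup i) (sym e))
  lookup-injective (_ ∷ u) {suc i} {suc j} e = cong suc (lookup-injective u e)

  module _ {R : Fin N → Fin N → Set} where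

    rotate : ∀ {u y} as bs → Path R u u (as ++ y ∷ bs) → Unique (as ++ y ∷ bs) →
             3 ≤ length (as ++ y ∷ bs) →
             Path R y y (y ∷ bs ++ as) × Unique (y ∷ bs ++ as) × 3 ≤ length (y ∷ bs ++ as)
    rotate as bs p u long with splitPath as p
    ... | _ , p₁ , (r ▸ p₂) = r ▸ (p₂ ++ₚ p₁) , unique-rotate as u ,
      ≤-trans long (≤-reflexive (length-++-comm as (_ ∷ bs)))

    tabulatePath : ∀ k (g : Fin (suc k) → Fin N) → (∀ (i : Fin k) → R (g (inject₁ i)) (g (suc i))) →
                   ∀ {z} → R (g (fromℕ k)) z → Path R (g zero) z (tabulate g)
    tabulatePath zero g steps last = last ▸ end
    tabulatePath (suc k) g steps last =
      steps zero ▸ tabulatePath k (λ i → g (suc i)) (λ i → steps (suc i)) last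

    fromCycle : Cycle R → ListCycle R
    fromCycle C = listCycle (tabulate vtx) (tabulatePath _ vtx consec close)
      (AllPairs.tabulate⁺ (λ i≢j e → i≢j (distinct e)))
      (≤-trans (s≤s (s≤s (s≤s z≤n))) (≤-reflexive (sym (length-tabulate vtx))))
      where open Cycle C

    pathStep : ∀ {u w} x xs → Path R u w (x ∷ xs) → ∀ (i : Fin (length xs)) →
               R (lookup (x ∷ xs) (inject₁ i)) (lookup (x ∷ xs) (suc i))
    pathStep x (_ ∷ _) (r ▸ (_ ▸ _)) zero = r
    pathStep x (x' ∷ xs) (_ ▸ p) (suc i) = pathStep x' xs p i

    pathLast : ∀ {u w} x xs → Path R u w (x ∷ xs) → R (lookup (x ∷ xs) (fromℕ (length xs))) w
    pathLast x [] (r ▸ end) = r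
    pathLast x (x' ∷ xs) (_ ▸ p) = pathLast x' xs p

    toCycle : ListCycle R → Cycle R
    toCycle (listCycle (a ∷ b ∷ c ∷ rest) p@(_ ▸ _) u _) = record
      { len = length rest ; vtx = lookup (a ∷ b ∷ c ∷ rest) ; distinct = lookup-injective u
      ; consec = pathStep a (b ∷ c ∷ rest) p ; close = pathLast a (b ∷ c ∷ rest) p }
    toCycle (listCycle [] _ _ ())
    toCycle (listCycle (_ ∷ []) _ _ (s≤s ()))
    toCycle (listCycle (_ ∷ _ ∷ []) _ _ (s≤s (s≤s ())))

  locate : (y : Fin N) (vs : List (Fin N)) → (∃₂ λ as bs → vs ≡ as ++ y ∷ bs) ⊎ All (y ≢_) vs
  locate y vs with y ∈? vs
  ... | yes y∈vs = inj₁ (∈-∃++ y∈vs)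
  ... | no y∉vs = inj₂ (¬Any⇒All¬ vs y∉vs)

  -- Think of R as the edge relation obtained from E by
  -- merging y into x: E-edges avoiding y are R-edges, an E-edge y–v gives an R-edge x–v,
  -- and x and y have no common E-neighbour (so no cycle collapses to length two).
  module Shortcut (x y : Fin N) (x≢y : x ≢ y) {E R : Fin N → Fin N → Set}
    (E-sym : ∀ {u v} → E u v → E v u) (R-sym : ∀ {u v} → R u v → R v u)
    (keep : ∀ {u v} → E u v → u ≢ y → v ≢ y → R u v)
    (redirect : ∀ {v} → E y v → v ≢ x → R x v)
    (no-common : ∀ {v} → E y v → ¬ E x v) where

    startAvoids : ∀ {w b vs} → Path E w b vs → All (y ≢_) vs → y ≢ b → y ≢ w
    startAvoids end _ y≢b = y≢b
    startAvoids (_ ▸ _) (y≢w ∷ _) _ = y≢w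

    closedAvoids : ∀ {w vs} → Path E w w vs → All (y ≢_) vs → 3 ≤ length vs → y ≢ w
    closedAvoids (_ ▸ _) (y≢w ∷ _) _ = y≢w

    keepPath : ∀ {a b vs} → Path E a b vs → All (y ≢_) vs → y ≢ b → Path R a b vs
    keepPath end _ _ = end
    keepPath (e ▸ p) (y≢a ∷ y∉) y≢b =
      keep e (≢-sym y≢a) (≢-sym (startAvoids p y∉ y≢b)) ▸ keepPath p y∉ y≢b

    retarget : ∀ {a w ws} → Path E a y (w ∷ ws) → All (y ≢_) (w ∷ ws) → All (x ≢_) (w ∷ ws) →
               Path R a x (w ∷ ws)
    retarget (e ▸ end) (_ ∷ []) (x≢w ∷ []) = R-sym (redirect (E-sym e) (≢-sym x≢w)) ▸ end
    retarget (e ▸ p@(_ ▸ _)) (y≢a ∷ y∉@(y≢w ∷ _)) (_ ∷ x∉) =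
      keep e (≢-sym y≢a) (≢-sym y≢w) ▸ retarget p y∉ x∉

    -- the cycle y as x bs: drop y and close up at x, through whichever arc has an inner vertex
    throughBoth : ∀ as bs → Path E y x (y ∷ as) → Path E x y (x ∷ bs) → All (y ≢_) (as ++ x ∷ bs) →
                  Unique (as ++ x ∷ bs) → 3 ≤ length (y ∷ as ++ x ∷ bs) → ListCycle R
    throughBoth [] [] _ _ _ _ (s≤s (s≤s ()))
    throughBoth [] (_ ∷ []) _ (e₁ ▸ e₂ ▸ end) _ _ _ = ⊥-elim (no-common (E-sym e₂) e₁)
    throughBoth [] (b₁ ∷ b₂ ∷ bs) _ (e ▸ p@(_ ▸ _)) (_ ∷ y∉@(y≢b₁ ∷ _)) (x∉ ∷ u) _ =
      listCycle (x ∷ b₁ ∷ b₂ ∷ bs) (keep e x≢y (≢-sym y≢b₁) ▸ retarget p y∉ x∉) (x∉ ∷ u)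
        (s≤s (s≤s (s≤s z≤n)))
    throughBoth (_ ∷ []) _ (e₁ ▸ e₂ ▸ end) _ _ _ _ = ⊥-elim (no-common e₁ (E-sym e₂))
    throughBoth as@(a₁ ∷ _ ∷ _) bs (e ▸ p@(_ ▸ _)) _ y∉ u _ with unique-++⁻ as u
    ... | uas , _ , (a₁∉ ∷ as∉) =
      listCycle (x ∷ as) (redirect e (All.head a₁∉) ▸ keepPath p (++⁻ˡ as y∉) (≢-sym x≢y))
        (x∉as ∷ uas) (s≤s (s≤s (s≤s z≤n)))
      where
      x∉as : All (x ≢_) as
      x∉as = ≢-sym (All.head a₁∉) ∷ All.map (λ z∉ → ≢-sym (All.head z∉)) as∉

    throughY : ∀ ws → Path E y y (y ∷ ws) → Unique (y ∷ ws) → 3 ≤ length (y ∷ ws) → ListCycle R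
    throughY ws p (y∉ ∷ u) long with locate x ws
    throughY _ p (y∉ ∷ u) long | inj₁ (as , bs , refl) with splitPath (y ∷ as) p
    ... | _ , p₁ , p₂@(_ ▸ _) = throughBoth as bs p₁ p₂ y∉ u long
    throughY [] _ _ (s≤s ()) | inj₂ _
    throughY (w ∷ ws) (e ▸ p@(_ ▸ _)) (y∉ ∷ u) long | inj₂ x∉@(x≢w ∷ _) =
      listCycle (x ∷ w ∷ ws) (redirect e (≢-sym x≢w) ▸ retarget p y∉ x∉) (x∉ ∷ u) long

    shortcut : ListCycle E → ListCycle R
    shortcut (listCycle vs p u long) with locate y vs
    shortcut (listCycle vs p u long) | inj₂ y∉ =
      listCycle vs (keepPath p y∉ (closedAvoids p y∉ long)) u long
    shortcut (listCycle _ p u long) | inj₁ (as , bs , refl) with rotate as bs p u long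
    ... | p' , u' , long' = throughY (bs ++ as) p' u' long'

open ListCycles

module Contraction {m : ℕ} {H : Graph (suc m)} {H' : Graph m}
  (x y : Fin (suc m)) (xy : Edge H x y) (φ : Fin (suc m) → Fin m)
  (fibres : ∀ u v → (φ u ≡ φ v) ⇔ (u ≡ v ⊎ SameEdge u v x y))
  (edges : ∀ a b → Edge H' a b ⇔ (a ≢ b × Σ (Fin (suc m)) λ u → Σ (Fin (suc m)) λ v →
                                   φ u ≡ a × φ v ≡ b × Edge H u v)) where

  open Equivalence

  x≢y : x ≢ y
  x≢y refl = edge-irrefl H xy

  φx≡φy : φ x ≡ φ y
  φx≡φy = from (fibres x y) (inj₂ (inj₁ (refl , refl)))

  φ-injective : ∀ {u v} → u ≢ v → u ≢ y → v ≢ y → φ u ≢ φ v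
  φ-injective u≢v u≢y v≢y eq with to (fibres _ _) eq
  ... | inj₁ u≡v = u≢v u≡v
  ... | inj₂ (inj₁ (_ , v≡y)) = v≢y v≡y
  ... | inj₂ (inj₂ (u≡y , _)) = u≢y u≡y

  image-edge : ∀ {u v} → Edge H u v → ¬ SameEdge u v x y → Edge H' (φ u) (φ v)
  image-edge {u} {v} e ¬xy = from (edges (φ u) (φ v)) (φu≢φv , u , v , refl , refl , e)
    where
    φu≢φv : φ u ≢ φ v
    φu≢φv eq with to (fibres u v) eq
    ... | inj₁ refl = edge-irrefl H e
    ... | inj₂ same = ¬xy same

  module _ {q : ℕ} (c' : Coloring H' q) where

    liftCol : ∀ i j → Edge H i j → Fin (suc q)
    liftCol i j e with same-edge? i j x y
    ... | yes _ = fromℕ q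
    ... | no ¬xy = inject₁ (Coloring.col c' (φ i) (φ j) (image-edge e ¬xy))

    liftColoring : Coloring H (suc q)
    liftColoring = record { col = liftCol ; colSym = liftCol-sym }
      where
      liftCol-sym : ∀ i j (e : Edge H i j) (e' : Edge H j i) → liftCol i j e ≡ liftCol j i e'
      liftCol-sym i j e e' with same-edge? i j x y | same-edge? j i x y
      ... | yes _ | yes _ = refl
      ... | yes xy | no ¬yx = ⊥-elim (¬yx (swap-edge xy))
      ... | no ¬xy | yes yx = ⊥-elim (¬xy (swap-edge yx))
      ... | no _ | no _ = cong inject₁ (Coloring.colSym c' (φ i) (φ j) _ _)

  both-xy : ∀ {i j k l} → SameEdge i j x y → SameEdge k l x y → SameEdge i j k l
  both-xy (inj₁ (refl , refl)) (inj₁ (refl , refl)) = inj₁ (refl , refl)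
  both-xy (inj₁ (refl , refl)) (inj₂ (refl , refl)) = inj₂ (refl , refl)
  both-xy (inj₂ (refl , refl)) (inj₁ (refl , refl)) = inj₂ (refl , refl)
  both-xy (inj₂ (refl , refl)) (inj₂ (refl , refl)) = inj₁ (refl , refl)

  module Lift (T' : Tree H') where
    open Tree T' using () renaming (V to V'; E to E'; Esym to E'-sym; Eends to E'-ends)

    -- Edges of the lift: xy if the merged vertex lies in T', and for each edge of T' one
    -- preimage edge, avoiding y whenever possible (if x–v is an edge, y–v is not used).
    data LiftE (u v : Fin (suc m)) : Set where
      kept   : u ≢ y → v ≢ y → E' (φ u) (φ v) → Edge H u v → LiftE u v
      fromY  : u ≡ y → v ≢ x → E' (φ x) (φ v) → ¬ Edge H x v → Edge H y v → LiftE u v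
      toY    : v ≡ y → u ≢ x → E' (φ u) (φ x) → ¬ Edge H x u → Edge H y u → LiftE u v
      merged : SameEdge u v x y → V' (φ x) → LiftE u v

    LiftE-sym : ∀ {u v} → LiftE u v → LiftE v u
    LiftE-sym (kept u≢y v≢y t e) = kept v≢y u≢y (E'-sym _ _ t) (edge-sym H e)
    LiftE-sym (fromY u≡y v≢x t ¬e e) = toY u≡y v≢x (E'-sym _ _ t) ¬e e
    LiftE-sym (toY v≡y u≢x t ¬e e) = fromY v≡y u≢x (E'-sym _ _ t) ¬e e
    LiftE-sym (merged same vx) = merged (swap-edge same) vx

    LiftE-inH : ∀ {u v} → LiftE u v → Edge H u v
    LiftE-inH (kept _ _ _ e) = e
    LiftE-inH (fromY refl _ _ _ e) = e
    LiftE-inH (toY refl _ _ _ e) = edge-sym H e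
    LiftE-inH (merged (inj₁ (refl , refl)) _) = xy
    LiftE-inH (merged (inj₂ (refl , refl)) _) = edge-sym H xy

    V'y : V' (φ x) → V' (φ y)
    V'y = subst V' φx≡φy

    LiftE-ends : ∀ {u v} → LiftE u v → V' (φ u) × V' (φ v)
    LiftE-ends (kept _ _ t _) = E'-ends _ _ t
    LiftE-ends (fromY refl _ t _ _) with E'-ends _ _ t
    ... | vx , vv = V'y vx , vv
    LiftE-ends (toY refl _ t _ _) with E'-ends _ _ t
    ... | vu , vx = vu , V'y vx
    LiftE-ends (merged (inj₁ (refl , refl)) vx) = vx , V'y vx
    LiftE-ends (merged (inj₂ (refl , refl)) vx) = V'y vx , vx

    -- Connectivity: a walk of T' lifts edge by edge, moving inside a fibre along xy.
    fibreWalk : ∀ u s → φ u ≡ φ s → V' (φ u) → Walk LiftE u s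
    fibreWalk u s eq vu with to (fibres u s) eq
    ... | inj₁ refl = here
    ... | inj₂ (inj₁ (refl , refl)) = step (merged (inj₁ (refl , refl)) vu) here
    ... | inj₂ (inj₂ (refl , refl)) =
      step (merged (inj₂ (refl , refl)) (subst V' (sym φx≡φy) vu)) here

    Over : Fin m → Fin m → Set
    Over a b = Σ (Fin (suc m)) λ s → Σ (Fin (suc m)) λ t → φ s ≡ a × φ t ≡ b × LiftE s t

    Over-sym : ∀ {a b} → Over a b → Over b a
    Over-sym (s , t , φs , φt , e) = t , s , φt , φs , LiftE-sym e

    overFromY : ∀ t → Edge H y t → E' (φ y) (φ t) → φ y ≢ φ t → Over (φ y) (φ t)
    overFromY t e te ne with T? (Graph.adj H x t)
    ... | yes ext = x , t , φx≡φy , refl , kept x≢y t≢y te' ext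
      where
      t≢y : t ≢ y
      t≢y refl = edge-irrefl H e
      te' : E' (φ x) (φ t)
      te' = subst (λ z → E' z (φ t)) (sym φx≡φy) te
    ... | no ¬ext = y , t , refl , refl ,
      fromY refl (λ { refl → ne (sym φx≡φy) }) (subst (λ z → E' z (φ t)) (sym φx≡φy) te) ¬ext e

    overEdge : ∀ s t → Edge H s t → E' (φ s) (φ t) → φ s ≢ φ t → Over (φ s) (φ t)
    overEdge s t e te ne with s ≟ y | t ≟ y
    ... | yes refl | _ = overFromY t e te ne
    ... | no _ | yes refl =
      Over-sym (overFromY s (edge-sym H e) (E'-sym _ _ te) (λ eq → ne (sym eq)))
    ... | no s≢y | no t≢y = s , t , refl , refl , kept s≢y t≢y te e

    over : ∀ {a b} → E' a b → Over a b
    over {a} {b} te with to (edges a b) (Tree.EinG T' a b te)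
    ... | ne , s , t , refl , refl , e = overEdge s t e te ne

    liftWalk : ∀ {a b} → Walk E' a b → V' a → ∀ u v → φ u ≡ a → φ v ≡ b → Walk LiftE u v
    liftWalk here va u v φu φv = fibreWalk u v (trans φu (sym φv)) (subst V' (sym φu) va)
    liftWalk (step te rest) va u v φu φv with over te
    ... | s , t , φs , φt , e =
      fibreWalk u s (trans φu (sym φs)) (subst V' (sym φu) va) ++ʷ
      step e (liftWalk rest (proj₂ (E'-ends _ _ te)) t v φt φv)

    LiftE-conn : ∀ u v → V' (φ u) → V' (φ v) → Walk LiftE u v
    LiftE-conn u v vu vv = liftWalk (Tree.conn T' (φ u) (φ v) vu vv) vu u v refl refl

    image-tree-edge : ∀ {u v} → LiftE u v → ¬ SameEdge u v x y → E' (φ u) (φ v)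
    image-tree-edge (kept _ _ t _) _ = t
    image-tree-edge {v = v} (fromY refl _ t _ _) _ = subst (λ z → E' z (φ v)) φx≡φy t
    image-tree-edge {u = u} (toY refl _ t _ _) _ = subst (E' (φ u)) φx≡φy t
    image-tree-edge (merged same _) ¬xy = ⊥-elim (¬xy same)

    Away : Fin (suc m) → Fin (suc m) → Set
    Away u v = u ≢ y × v ≢ y × E' (φ u) (φ v)

    -- merging y into x turns the lift into (a copy of part of) T'; the hypotheses of Shortcut
    keepAway : ∀ {u v} → LiftE u v → u ≢ y → v ≢ y → Away u v
    keepAway e u≢y v≢y =
      u≢y , v≢y , image-tree-edge e λ { (inj₁ (_ , v≡y)) → v≢y v≡y ; (inj₂ (u≡y , _)) → u≢y u≡y }

    redirectY : ∀ {v} → LiftE y v → v ≢ x → Away x v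
    redirectY (kept y≢y _ _ _) _ = ⊥-elim (y≢y refl)
    redirectY (fromY _ _ t _ e) _ = x≢y , (λ { refl → edge-irrefl H e }) , t
    redirectY (toY refl _ _ _ e) _ = ⊥-elim (edge-irrefl H e)
    redirectY (merged (inj₁ (y≡x , _)) _) _ = ⊥-elim (x≢y (sym y≡x))
    redirectY (merged (inj₂ (_ , v≡x)) _) v≢x = ⊥-elim (v≢x v≡x)

    noCommon : ∀ {v} → LiftE y v → ¬ LiftE x v
    noCommon (kept y≢y _ _ _) _ = y≢y refl
    noCommon (fromY _ _ _ ¬ext _) e = ¬ext (LiftE-inH e)
    noCommon (toY refl _ _ _ e) _ = edge-irrefl H e
    noCommon (merged (inj₁ (y≡x , _)) _) _ = x≢y (sym y≡x)
    noCommon (merged (inj₂ (_ , refl)) _) e = edge-irrefl H (LiftE-inH e)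

    open Shortcut x y x≢y LiftE-sym (λ (u≢y , v≢y , t) → v≢y , u≢y , E'-sym _ _ t)
      keepAway redirectY noCommon using (shortcut)

    -- φ maps an Away-cycle injectively onto a cycle of T'
    awayVerts : ∀ {a b vs} → Path Away a b vs → All (_≢ y) vs
    awayVerts end = []
    awayVerts ((a≢y , _ , _) ▸ p) = a≢y ∷ awayVerts p

    imagePath : ∀ {a b vs} → Path Away a b vs → Path E' (φ a) (φ b) (map φ vs)
    imagePath end = end
    imagePath ((_ , _ , t) ▸ p) = t ▸ imagePath p

    imageUnique : ∀ {vs} → Unique vs → All (_≢ y) vs → Unique (map φ vs)
    imageUnique [] [] = []
    imageUnique (z∉ ∷ u) (z≢y ∷ vs≢y) = distinctImages z∉ vs≢y ∷ imageUnique u vs≢y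
      where
      distinctImages : ∀ {ws} → All (_ ≢_) ws → All (_≢ y) ws → All (φ _ ≢_) (map φ ws)
      distinctImages [] [] = []
      distinctImages (z≢w ∷ z∉) (w≢y ∷ ws≢y) = φ-injective z≢w z≢y w≢y ∷ distinctImages z∉ ws≢y

    imageCycle : ListCycle Away → ListCycle E'
    imageCycle (listCycle vs p u long) = listCycle (map φ vs) (imagePath p)
      (imageUnique u (awayVerts p)) (≤-trans long (≤-reflexive (sym (length-map φ vs))))

    LiftE-acyclic : ¬ Cycle LiftE
    LiftE-acyclic C = Tree.acyclic T' (toCycle (imageCycle (shortcut (fromCycle C))))

    liftTree : Tree H
    liftTree = record
      { V = λ u → V' (φ u) ; E = LiftE ; Esym = λ _ _ → LiftE-sym ; EinG = λ _ _ → LiftE-inH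
      ; Eends = λ _ _ → LiftE-ends ; conn = LiftE-conn ; acyclic = LiftE-acyclic }

    lift-injective : ∀ {i j k l} → LiftE i j → ¬ SameEdge i j x y → LiftE k l →
                     φ i ≡ φ k → φ j ≡ φ l → i ≡ k × j ≡ l
    lift-injective {i} {j} {k} {l} e ¬xy e' φik φjl with to (fibres i k) φik | to (fibres j l) φjl
    ... | inj₁ i≡k | inj₁ j≡l = i≡k , j≡l
    ... | inj₁ refl | inj₂ (inj₁ (refl , refl)) = ⊥-elim (noCommon (LiftE-sym e') (LiftE-sym e))
    ... | inj₁ refl | inj₂ (inj₂ (refl , refl)) = ⊥-elim (noCommon (LiftE-sym e) (LiftE-sym e'))
    ... | inj₂ (inj₁ (refl , refl)) | inj₁ refl = ⊥-elim (noCommon e' e)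
    ... | inj₂ (inj₂ (refl , refl)) | inj₁ refl = ⊥-elim (noCommon e e')
    ... | inj₂ (inj₁ (refl , refl)) | inj₂ (inj₁ (refl , refl)) = ⊥-elim (edge-irrefl H (LiftE-inH e))
    ... | inj₂ (inj₁ (refl , refl)) | inj₂ (inj₂ (refl , refl)) = ⊥-elim (¬xy (inj₁ (refl , refl)))
    ... | inj₂ (inj₂ (refl , refl)) | inj₂ (inj₁ (refl , refl)) = ⊥-elim (¬xy (inj₂ (refl , refl)))
    ... | inj₂ (inj₂ (refl , refl)) | inj₂ (inj₂ (refl , refl)) = ⊥-elim (edge-irrefl H (LiftE-inH e))

    liftRainbow : ∀ {q} (c' : Coloring H' q) → Rainbow c' T' → Rainbow (liftColoring c') liftTree
    liftRainbow c' rainbow i j k l e e' eq with same-edge? i j x y | same-edge? k l x y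
    ... | yes ij≡xy | yes kl≡xy = both-xy ij≡xy kl≡xy
    ... | yes _ | no _ = ⊥-elim (fromℕ≢inject₁ eq)
    ... | no _ | yes _ = ⊥-elim (fromℕ≢inject₁ (sym eq))
    ... | no ¬ij | no ¬kl
      with rainbow (φ i) (φ j) (φ k) (φ l) (image-tree-edge e ¬ij) (image-tree-edge e' ¬kl)
             (trans (col-irrelevant c' _ _) (trans (inject₁-injective eq) (col-irrelevant c' _ _)))
    ... | inj₁ (φik , φjl) = inj₁ (lift-injective e ¬ij e' φik φjl)
    ... | inj₂ (φil , φjk) = inj₂ (lift-injective e ¬ij (LiftE-sym e') φil φjk)

third : ∀ {m} → 3 ≤ m → (a b : Fin m) → Σ (Fin m) λ d → a ≢ d × b ≢ d
third (s≤s (s≤s (s≤s _))) zero zero = suc zero , (λ ()) , (λ ())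
third (s≤s (s≤s (s≤s _))) zero (suc zero) = suc (suc zero) , (λ ()) , (λ ())
third (s≤s (s≤s (s≤s _))) zero (suc (suc b)) = suc zero , (λ ()) , (λ ())
third (s≤s (s≤s (s≤s _))) (suc zero) zero = suc (suc zero) , (λ ()) , (λ ())
third (s≤s (s≤s (s≤s _))) (suc zero) (suc zero) = zero , (λ ()) , (λ ())
third (s≤s (s≤s (s≤s _))) (suc zero) (suc (suc b)) = zero , (λ ()) , (λ ())
third (s≤s (s≤s (s≤s _))) (suc (suc a)) zero = suc zero , (λ ()) , (λ ())
third (s≤s (s≤s (s≤s _))) (suc (suc a)) (suc zero) = zero , (λ ()) , (λ ())
third (s≤s (s≤s (s≤s _))) (suc (suc a)) (suc (suc b)) = zero , (λ ()) , (λ ())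

module _ {m q} {G : Graph m} (c : Coloring G q) (rainbow : Is3Rainbow c) (m≥3 : 3 ≤ m) where

  coverPair : ∀ {a b} → a ≢ b → Σ (Tree G) λ T → Rainbow c T × Tree.V T a × Tree.V T b
  coverPair {a} {b} a≢b with third m≥3 a b
  ... | d , a≢d , b≢d with rainbow a b d a≢b a≢d b≢d
  ... | T , rT , va , vb , _ = T , rT , va , vb

  coverTriple : ∀ a b d → Σ (Tree G) λ T → Rainbow c T × Tree.V T a × Tree.V T b × Tree.V T d
  coverTriple a b d with a ≟ b | a ≟ d | b ≟ d
  ... | no a≢b | no a≢d | no b≢d = rainbow a b d a≢b a≢d b≢d
  ... | no a≢b | yes refl | _ with coverPair a≢b
  ...   | T , rT , va , vb = T , rT , va , vb , va
  coverTriple a b d | no a≢b | no _ | yes refl with coverPair a≢b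
  ...   | T , rT , va , vb = T , rT , va , vb , vb
  coverTriple a b d | yes refl | _ | no b≢d with coverPair b≢d
  ...   | T , rT , vb , vd = T , rT , vb , vb , vd
  coverTriple a b d | yes refl | _ | yes refl with third m≥3 a a
  ...   | e , a≢e , _ with coverPair a≢e
  ...     | T , rT , va , _ = T , rT , va , va , va

contract-step : ∀ {m} {H : Graph (suc m)} {H' : Graph m} → ContractOne H H' → 3 ≤ m →
                ∀ {q} → Has3RainbowColoring H' q → Has3RainbowColoring H (suc q)
contract-step (x , y , xy , φ , _ , fibres , edges) m≥3 (c' , rainbow') = liftColoring c' , rainbow
  where
  open Contraction x y xy φ fibres edges
  rainbow : Is3Rainbow (liftColoring c')
  rainbow u v w _ _ _ with coverTriple c' rainbow' m≥3 (φ u) (φ v) (φ w)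
  ... | T' , rT' , vu , vv , vw = Lift.liftTree T' , Lift.liftRainbow T' c' rT' , vu , vv , vw

module Pullback {n m} {G : Graph n} {G' : Graph m} (φ : Fin n → Fin m)
  (φ-injective : Injective _≡_ _≡_ φ) (φ-surjective : Surjective _≡_ _≡_ φ)
  (φ-adj : ∀ u v → Graph.adj G' (φ u) (φ v) ≡ Graph.adj G u v) where

  preimage : Fin m → Fin n
  preimage w = proj₁ (φ-surjective w)

  φ-preimage : ∀ w → φ (preimage w) ≡ w
  φ-preimage w = proj₂ (φ-surjective w) refl

  toG' : ∀ {u v} → Edge G u v → Edge G' (φ u) (φ v)
  toG' {u} {v} = subst T (sym (φ-adj u v))

  fromG' : ∀ {u v} → Edge G' (φ u) (φ v) → Edge G u v
  fromG' {u} {v} = subst T (φ-adj u v)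

  pullColoring : ∀ {q} → Coloring G' q → Coloring G q
  pullColoring c' = record
    { col = λ i j e → Coloring.col c' (φ i) (φ j) (toG' e)
    ; colSym = λ i j e e' → Coloring.colSym c' (φ i) (φ j) (toG' e) (toG' e') }

  module _ (T' : Tree G') where
    open Tree T' using () renaming (V to V'; E to E')

    pullWalk : ∀ {a b} → Walk E' a b → ∀ u v → φ u ≡ a → φ v ≡ b → Walk (λ i j → E' (φ i) (φ j)) u v
    pullWalk here u v φu φv with φ-injective (trans φu (sym φv))
    ... | refl = here
    pullWalk (step {w = w} e rest) u v φu φv =
      step (subst₂ E' (sym φu) (sym (φ-preimage w)) e)
           (pullWalk rest (preimage w) v (φ-preimage w) φv)

    pullCycle : Cycle (λ i j → E' (φ i) (φ j)) → Cycle E'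
    pullCycle C = record
      { len = Cycle.len C ; vtx = λ i → φ (Cycle.vtx C i)
      ; distinct = λ e → Cycle.distinct C (φ-injective e)
      ; consec = Cycle.consec C ; close = Cycle.close C }

    pullTree : Tree G
    pullTree = record
      { V = λ u → V' (φ u) ; E = λ i j → E' (φ i) (φ j)
      ; Esym = λ i j → Tree.Esym T' (φ i) (φ j)
      ; EinG = λ i j e → fromG' (Tree.EinG T' (φ i) (φ j) e)
      ; Eends = λ i j → Tree.Eends T' (φ i) (φ j)
      ; conn = λ u v vu vv → pullWalk (Tree.conn T' (φ u) (φ v) vu vv) u v refl refl
      ; acyclic = λ C → Tree.acyclic T' (pullCycle C) }

    pullRainbow : ∀ {q} (c' : Coloring G' q) → Rainbow c' T' → Rainbow (pullColoring c') pullTree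
    pullRainbow c' rainbow i j k l e e' eq
      with rainbow (φ i) (φ j) (φ k) (φ l) e e'
             (trans (col-irrelevant c' _ _) (trans eq (col-irrelevant c' _ _)))
    ... | inj₁ (φik , φjl) = inj₁ (φ-injective φik , φ-injective φjl)
    ... | inj₂ (φil , φjk) = inj₂ (φ-injective φil , φ-injective φjk)

  pullback : ∀ {q} → Has3RainbowColoring G' q → Has3RainbowColoring G q
  pullback (c' , rainbow') = pullColoring c' , rainbow
    where
    rainbow : Is3Rainbow (pullColoring c')
    rainbow u v w u≢v u≢w v≢w
      with rainbow' (φ u) (φ v) (φ w) (λ e → u≢v (φ-injective e)) (λ e → u≢w (φ-injective e))
             (λ e → v≢w (φ-injective e))
    ... | T' , rT' , vu , vv , vw = pullTree T' , pullRainbow T' c' rT' , vu , vv , vw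

more-colors : ∀ {n} {G : Graph n} {q q'} → q ≤ q' →
              Has3RainbowColoring G q → Has3RainbowColoring G q'
more-colors {G = G} q≤q' (c , rainbow) =
  c⁺ , λ u v w u≢v u≢w v≢w → stillRainbow (rainbow u v w u≢v u≢w v≢w)
  where
  c⁺ : Coloring G _
  c⁺ = record { col = λ i j e → inject≤ (Coloring.col c i j e) q≤q'
              ; colSym = λ i j e e' → cong (λ z → inject≤ z q≤q') (Coloring.colSym c i j e e') }
  stillRainbow : ∀ {u v w} → (Σ (Tree G) λ T → Rainbow c T × Tree.V T u × Tree.V T v × Tree.V T w) →
                 Σ (Tree G) λ T → Rainbow c⁺ T × Tree.V T u × Tree.V T v × Tree.V T w
  stillRainbow (T , rT , vu , vv , vw) =
    T , (λ i j k l e e' eq → rT i j k l e e' (inject≤-injective q≤q' q≤q' _ _ eq)) , vu , vv , vw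

order-decreases : ∀ {n m} {G : Graph n} {H : Graph m} → ContractsTo G H → m ≤ n
order-decreases {G = G} {H = H} (none (φ , φ-injective , φ-surjective , φ-adj)) =
  injective⇒≤ {f = preimage}
    (λ {a} {b} eq → trans (sym (φ-preimage a)) (trans (cong φ eq) (φ-preimage b)))
  where open Pullback {G = G} {G' = H} φ φ-injective φ-surjective φ-adj
order-decreases (more c _) = ≤-trans (n≤1+n _) (order-decreases c)

contraction-bound : ∀ {n m} {G : Graph n} {G' : Graph m} → ContractsTo G G' → 3 ≤ m →
                    ∀ {q} → Has3RainbowColoring G' q → Has3RainbowColoring G (q + (n ∸ m))
contraction-bound {G = G} {G' = G'} (none (φ , φ-injective , φ-surjective , φ-adj)) _ colored =
  more-colors (m≤m+n _ _)
    (Pullback.pullback {G = G} {G' = G'} φ φ-injective φ-surjective φ-adj colored)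
contraction-bound {n} {G = G} (more {m = k} contraction last) m≥3 {q} colored =
  subst (Has3RainbowColoring G) colors
    (contraction-bound contraction (≤-trans m≥3 (n≤1+n k)) (contract-step last m≥3 colored))
  where
  open ≡-Reasoning
  colors : suc q + (n ∸ suc k) ≡ q + (n ∸ k)
  colors = begin
    suc q + (n ∸ suc k)  ≡⟨ sym (+-suc q (n ∸ suc k)) ⟩
    q + suc (n ∸ suc k)  ≡⟨ cong (q +_) (sym (+-∸-assoc 1 (order-decreases contraction))) ⟩
    q + (n ∸ k)          ∎

-- rx₃(G) ≤ rx₃(G') + (n ∸ m): a minimal coloring of G' yields one of G of the claimed size
-- (connectedness is only needed for rx₃ to exist, which the IsRx3 hypotheses already provide)
lemma2 : ∀ {n m : ℕ} (G : Graph n) (G' : Graph m) →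
         Connected G → Connected G' → 3 ≤ m → ContractsTo G G' →
         ∀ (k k' : ℕ) → IsRx3 G k → IsRx3 G' k' → k ≤ k' + (n ∸ m)
lemma2 G G' _ _ m≥3 contraction k k' (_ , k-minimal) (colored' , _) =
  k-minimal _ (contraction-bound contraction m≥3 colored')
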